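{- Let $n\ge3$ be an integer. If $n$ is odd, then every spiky function on $E_n$ is the connectivity function of a matroid on $E_n$. If $n$ is even, then a spiky function $\lambda$ on $E_n$ is the connectivity function of a matroid on $E_n$ if and only if there is no transversal $X$ such that $X$ and $E_n-X$ lie in the same connected component of $G_\lambda$.
   Context: Let $L_i=\{x_i,y_i\}$ ($i=1,\dots,n$) be pairwise disjoint two-element sets and $E_n=L_1\cup\dots\cup L_n$. A transversal is a set $\{z_1,\dots,z_n\}$ with $z_i\in\{x_i,y_i\}$; $\mathcal T_n$ is the set of transversals. $H_n$ is the graph on $\mathcal T_n$ in which two transversals are adjacent when they differ in exactly one element. For $X\subseteq E_n$ let $l(X)$ be the number of sets $L_i$ meeting $X$. Define $r_n$ on $2^{E_n}-\mathcal T_n$ by: if $X$ includes no $L_i$ and is disjoint from some $L_i$, $r_n(X)=|X|$; if $X$ includes some $L_i$ and is disjoint from some other $L_j$, $r_n(X)=l(X)+1$; if $X$ includes some $L_i$ and meets all $L_j$, $r_n(X)=n$. Let $\lambda_n(X)=r_n(X)+r_n(E_n-X)-n$ for $X\notin\mathcal T_n$. A function $\lambda:2^{E_n}\to\mathbb N$ is spiky if it is symmetric ($\lambda(X)=\lambda(E_n-X)$), agrees with $\lambda_n$ off $\mathcal T_n$, takes values in $\{n-2,n-1,n\}$ on $\mathcal T_n$, and satisfies $\lambda(X)+\lambda(Y)\ge2n-2$ for transversals $X,Y$ differing in exactly one element. For a spiky $\lambda$, $G_\lambda$ is the induced subgraph of $H_n$ on the transversals $X$ with $\lambda(X)=n-1$.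 The connectivity function of a matroid $M$ on $E$ with rank function $r$ is $\mu_M(X)=r(X)+r(E-X)-r(E)$. -}

module Defs where

open import Data.Nat using (ℕ; zero; suc; _+_; _∸_; _≤_)
open import Data.Bool using (Bool; true; false; not; _∧_; _∨_; _xor_; if_then_else_)
open import Data.Product using (_×_; _,_; proj₁; proj₂; ∃; Σ)
open import Data.Sum using (_⊎_)
open import Data.Vec using (Vec; []; _∷_; map; zipWith; foldr; replicate; lookup)
open import Data.Fin using (Fin)
open import Relation.Binary.PropositionalEquality using (_≡_; _≢_)
open import Relation.Nullary using (¬_)

-- Ground set E_n: the 2n elements x_i, y_i (i : Fin n).
-- A subset X ⊆ E_n is a vector whose i-th entry (a , b) records
-- a = (x_i ∈ X) and b = (y_i ∈ X).
Sub : ℕ → Set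
Sub n = Vec (Bool × Bool) n

_∋x_ : ∀ {n} → Sub n → Fin n → Bool
X ∋x i = proj₁ (lookup X i)

_∋y_ : ∀ {n} → Sub n → Fin n → Bool
X ∋y i = proj₂ (lookup X i)

full : ∀ n → Sub n
full n = replicate n (true , true)

comp : ∀ {n} → Sub n → Sub n
comp = map (λ p → not (proj₁ p) , not (proj₂ p))

_∪_ : ∀ {n} → Sub n → Sub n → Sub n
_∪_ = zipWith (λ p q → (proj₁ p ∨ proj₁ q) , (proj₂ p ∨ proj₂ q))

_∩_ : ∀ {n} → Sub n → Sub n → Sub n
_∩_ = zipWith (λ p q → (proj₁ p ∧ proj₁ q) , (proj₂ p ∧ proj₂ q))

_⊆_ : ∀ {n} → Sub n → Sub n → Set
_⊆_ {n} X Y = (i : Fin n) →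
  ((X ∋x i) ≡ true → (Y ∋x i) ≡ true) × ((X ∋y i) ≡ true → (Y ∋y i) ≡ true)

b2n : Bool → ℕ
b2n true = 1
b2n false = 0

countV : ∀ {n} → (Bool × Bool → ℕ) → Sub n → ℕ
countV f = foldr _ (λ p k → f p + k) 0

card : ∀ {n} → Sub n → ℕ
card = countV (λ p → b2n (proj₁ p) + b2n (proj₂ p))

l : ∀ {n} → Sub n → ℕ
l = countV (λ p → b2n (proj₁ p ∨ proj₂ p))

anyIncl : ∀ {n} → Sub n → Bool
anyIncl = foldr _ (λ p b → (proj₁ p ∧ proj₂ p) ∨ b) false

allMeet : ∀ {n} → Sub n → Bool
allMeet = foldr _ (λ p b → (proj₁ p ∨ proj₂ p) ∧ b) true

Transversal : ∀ {n} → Sub n → Set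
Transversal {n} X = (i : Fin n) → ((X ∋x i) xor (X ∋y i)) ≡ true

-- r_n (only meaningful off transversals; on transversals it returns |X| = n,
-- a value that is never used)
rn : ∀ {n} → Sub n → ℕ
rn {n} X = if anyIncl X then (if allMeet X then n else suc (l X)) else card X

λn : ∀ {n} → Sub n → ℕ
λn {n} X = rn X + rn (comp X) ∸ n

diffCount : ∀ {n} → Sub n → Sub n → ℕ
diffCount [] [] = 0
diffCount (p ∷ X) (q ∷ Y) =
  b2n ((proj₁ p xor proj₁ q) ∨ (proj₂ p xor proj₂ q)) + diffCount X Y

Adj : ∀ {n} → Sub n → Sub n → Set
Adj {n} X Y = Transversal X × Transversal Y × diffCount X Y ≡ 1

record Spiky (n : ℕ) (λf : Sub n → ℕ) : Set where
  field
    symmetric : ∀ X → λf X ≡ λf (comp X)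
    agrees    : ∀ X → ¬ Transversal X → λf X ≡ λn X
    values    : ∀ X → Transversal X →
                  (λf X ≡ n ∸ 2) ⊎ (λf X ≡ n ∸ 1) ⊎ (λf X ≡ n)
    adjacent  : ∀ X Y → Adj X Y → (n + n) ∸ 2 ≤ λf X + λf Y

InG : ∀ {n} → (Sub n → ℕ) → Sub n → Set
InG {n} λf X = Transversal X × λf X ≡ n ∸ 1

data Reach {n} (λf : Sub n → ℕ) : Sub n → Sub n → Set where
  here : ∀ {X} → InG λf X → Reach λf X X
  step : ∀ {X Y Z} → InG λf X → Adj X Y → Reach λf Y Z → Reach λf X Z

record Matroid (n : ℕ) : Set where
  field
    r        : Sub n → ℕ
    r-card   : ∀ X → r X ≤ card X
    r-mono   : ∀ X Y → X ⊆ Y → r X ≤ r Y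
    r-submod : ∀ X Y → r (X ∪ Y) + r (X ∩ Y) ≤ r X + r Y

μ : ∀ {n} → Matroid n → Sub n → ℕ
μ {n} M X = r X + r (comp X) ∸ r (full n)
  where open Matroid M

IsConnFn : ∀ {n} → (Sub n → ℕ) → Set
IsConnFn {n} λf = Σ (Matroid n) (λ M → ∀ X → λf X ≡ μ M X)

module Submission where

-- With g(X) = l(X) + [X includes some L_i] we have r_n = min(n, g); g is
-- monotone and submodular, so r_n is a rank function.  Relaxing a set D of
-- pairwise non-adjacent transversals (lowering their rank by one) keeps the
-- rank axioms, and the connectivity function becomes λ_n off transversals
-- and n − [X ∈ D] − [E_n − X ∈ D] on them.  Hence a spiky λ is one as soon
-- as G_λ has a proper 2-colouring swapped by complementation (relax λ = n − 2
-- and colour true).  For odd n the parity of |X ∩ {x_1,…,x_n}| is such a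
-- colouring; for even n with no transversal reaching its complement, so is
-- the parity xor a side bit chosen per pair of components C, E_n − C using
-- decidable reachability.  Conversely, for even n and λ = μ_M, r(E_n) = n
-- and [T spans M] xor parity is constant on components of G_λ but negated
-- by complementation.

open import Defs
open import Data.Nat using (ℕ; _≤_; _%_)
open import Data.Product using (_×_; ∃)
open import Relation.Binary.PropositionalEquality using (_≡_)
open import Relation.Nullary using (¬_)
open import Function.Bundles using (_⇔_)

open import Data.Bool using (Bool; true; false; not; _∧_; _∨_; _xor_; if_then_else_)
import Data.Bool as Bool
open import Data.Bool.Properties
  using ( ∨-comm; ∧-comm; ∨-idem; ∧-idem; ∨-abs-∧; ∧-abs-∨; ∨-zeroʳ; not-involutive; ¬-not; not-¬
        ; xor-comm; xor-assoc; xor-identityʳ; not-distribˡ-xor; not-distribʳ-xor )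
open import Data.Empty using (⊥; ⊥-elim)
import Data.Fin as Fin
open import Data.List using (List; cartesianProductWith) renaming ([] to []ᴸ; _∷_ to _∷ᴸ_)
open import Data.List.Membership.Propositional using (_∈_)
open import Data.List.Membership.Propositional.Properties using (∈-cartesianProductWith⁺)
open import Data.List.Relation.Unary.Any using (Any; here; there)
import Data.List.Relation.Unary.Any as Any
open import Data.Nat using (zero; suc; _+_; _∸_; _<_; _⊓_; z≤n; s≤s; s≤s⁻¹)
open import Data.Nat.DivMod using ([m+n]%n≡m%n)
open import Data.Nat.Properties
open import Algebra.Properties.CommutativeSemigroup +-commutativeSemigroup
  using () renaming (interchange to +-interchange)
open import Data.Nat.Tactic.RingSolver using (solve-∀)
open import Data.Product using (_,_; proj₁; proj₂)
open import Data.Product.Properties using () renaming (≡-dec to ×-≡-dec)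
open import Data.Sum using (_⊎_; inj₁; inj₂)
open import Data.Vec using ([]; _∷_; replicate)
open import Data.Vec.Properties using (lookup-replicate; zipWith-comm; zipWith-absorbs; zipWith-idem; ≡-dec)
open import Function using (_∘_; id)
open import Function.Bundles using (mk⇔)
open import Relation.Binary.PropositionalEquality
  using (refl; sym; trans; cong; cong₂; subst; _≢_; module ≡-Reasoning)
open import Relation.Nullary using (Dec; does; yes; no; contradiction)
open import Relation.Nullary.Decidable using (map′; _×-dec_; _⊎-dec_; does-⇔; dec-true; dec-false)

true≢false : true ≢ false
true≢false ()

∨-implied : ∀ {a c} → (a ≡ true → c ≡ true) → a ∨ c ≡ c
∨-implied {false} h = refl
∨-implied {true}  h = sym (h refl)

∨-introˡ : ∀ {a} b → a ≡ true → a ∨ b ≡ true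
∨-introˡ b refl = refl

∨-introʳ : ∀ a {b} → b ≡ true → a ∨ b ≡ true
∨-introʳ a refl = ∨-zeroʳ a

∨-elim : ∀ a {b} → a ∨ b ≡ true → a ≡ true ⊎ b ≡ true
∨-elim true  e = inj₁ refl
∨-elim false e = inj₂ e

not-xor-not : ∀ a b → not a xor not b ≡ a xor b
not-xor-not true  b = refl
not-xor-not false b = not-involutive b

b2n≤1 : ∀ b → b2n b ≤ 1
b2n≤1 true  = s≤s z≤n
b2n≤1 false = z≤n

b2n-mono : ∀ {a b} → (a ≡ true → b ≡ true) → b2n a ≤ b2n b
b2n-mono {false} h = z≤n
b2n-mono {true}  h rewrite h refl = ≤-refl

b2n-injective : ∀ {a b} → b2n a ≡ b2n b → a ≡ b
b2n-injective {false} {false} _ = refl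
b2n-injective {true}  {true}  _ = refl

∪-comm : ∀ {n} (X Y : Sub n) → X ∪ Y ≡ Y ∪ X
∪-comm = zipWith-comm (λ (a , b) (c , d) → cong₂ _,_ (∨-comm a c) (∨-comm b d))

∩-comm : ∀ {n} (X Y : Sub n) → X ∩ Y ≡ Y ∩ X
∩-comm = zipWith-comm (λ (a , b) (c , d) → cong₂ _,_ (∧-comm a c) (∧-comm b d))

∪-idem : ∀ {n} (X : Sub n) → X ∪ X ≡ X
∪-idem = zipWith-idem (λ (a , b) → cong₂ _,_ (∨-idem a) (∨-idem b))

∩-idem : ∀ {n} (X : Sub n) → X ∩ X ≡ X
∩-idem = zipWith-idem (λ (a , b) → cong₂ _,_ (∧-idem a) (∧-idem b))

∪-absorbs-∩ : ∀ {n} (X Y : Sub n) → X ∪ (X ∩ Y) ≡ X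
∪-absorbs-∩ = zipWith-absorbs (λ (a , b) (c , d) → cong₂ _,_ (∨-abs-∧ a c) (∨-abs-∧ b d))

∩-absorbs-∪ : ∀ {n} (X Y : Sub n) → X ∩ (X ∪ Y) ≡ X
∩-absorbs-∪ = zipWith-absorbs (λ (a , b) (c , d) → cong₂ _,_ (∧-abs-∨ a c) (∧-abs-∨ b d))

⊆⇒∪≡ : ∀ {n} (X Y : Sub n) → X ⊆ Y → X ∪ Y ≡ Y
⊆⇒∪≡ []      []      _ = refl
⊆⇒∪≡ (_ ∷ X) (_ ∷ Y) h =
  cong₂ _∷_ (cong₂ _,_ (∨-implied (proj₁ (h Fin.zero))) (∨-implied (proj₂ (h Fin.zero))))
            (⊆⇒∪≡ X Y (λ i → h (Fin.suc i)))

⊆⇒∩≡ : ∀ {n} (X Y : Sub n) → X ⊆ Y → Y ∩ X ≡ X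
⊆⇒∩≡ X Y h = trans (∩-comm Y X) (subst (λ Z → X ∩ Z ≡ X) (⊆⇒∪≡ X Y h) (∩-absorbs-∪ X Y))

comp-involutive : ∀ {n} (X : Sub n) → comp (comp X) ≡ X
comp-involutive []            = refl
comp-involutive ((a , b) ∷ X) =
  cong₂ _∷_ (cong₂ _,_ (not-involutive a) (not-involutive b)) (comp-involutive X)

comp-∪ : ∀ {n} (X Y : Sub n) → comp (X ∪ Y) ≡ comp X ∩ comp Y
comp-∪ []            []            = refl
comp-∪ ((a , b) ∷ X) ((c , d) ∷ Y) =
  cong₂ _∷_ (cong₂ _,_ (deMorgan a c) (deMorgan b d)) (comp-∪ X Y)
  where
  deMorgan : ∀ a c → not (a ∨ c) ≡ not a ∧ not c
  deMorgan true  c = refl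
  deMorgan false c = refl

⊆full : ∀ {n} (X : Sub n) → X ⊆ full n
⊆full {n} X i = (λ _ → cong proj₁ (lookup-replicate i (true , true)))
              , (λ _ → cong proj₂ (lookup-replicate i (true , true)))

data Tr : ∀ {n} → Sub n → Set where
  []  : Tr []
  x∷_ : ∀ {n} {X : Sub n} → Tr X → Tr ((true , false) ∷ X)
  y∷_ : ∀ {n} {X : Sub n} → Tr X → Tr ((false , true) ∷ X)

tr? : ∀ {n} (X : Sub n) → Dec (Tr X)
tr? []                    = yes []
tr? ((true , false) ∷ X)  = map′ x∷_ (λ { (x∷ t) → t }) (tr? X)
tr? ((false , true) ∷ X)  = map′ y∷_ (λ { (y∷ t) → t }) (tr? X)
tr? ((true , true) ∷ X)   = no (λ ())
tr? ((false , false) ∷ X) = no (λ ())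

Tr⇒Transversal : ∀ {n} {X : Sub n} → Tr X → Transversal X
Tr⇒Transversal (x∷ t) Fin.zero    = refl
Tr⇒Transversal (y∷ t) Fin.zero    = refl
Tr⇒Transversal (x∷ t) (Fin.suc i) = Tr⇒Transversal t i
Tr⇒Transversal (y∷ t) (Fin.suc i) = Tr⇒Transversal t i

Transversal⇒Tr : ∀ {n} (X : Sub n) → Transversal X → Tr X
Transversal⇒Tr []                    t = []
Transversal⇒Tr ((true , false) ∷ X)  t = x∷ Transversal⇒Tr X (λ i → t (Fin.suc i))
Transversal⇒Tr ((false , true) ∷ X)  t = y∷ Transversal⇒Tr X (λ i → t (Fin.suc i))
Transversal⇒Tr ((true , true) ∷ X)   t with () ← t Fin.zero
Transversal⇒Tr ((false , false) ∷ X) t with () ← t Fin.zero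

Tr-comp : ∀ {n} {X : Sub n} → Tr X → Tr (comp X)
Tr-comp []     = []
Tr-comp (x∷ t) = y∷ Tr-comp t
Tr-comp (y∷ t) = x∷ Tr-comp t

Tr-card : ∀ {n} {X : Sub n} → Tr X → card X ≡ n
Tr-card []     = refl
Tr-card (x∷ t) = cong suc (Tr-card t)
Tr-card (y∷ t) = cong suc (Tr-card t)

Tr-noIncl : ∀ {n} {X : Sub n} → Tr X → anyIncl X ≡ false
Tr-noIncl []     = refl
Tr-noIncl (x∷ t) = Tr-noIncl t
Tr-noIncl (y∷ t) = Tr-noIncl t

¬Tr-incl : ∀ {n p} {X : Sub n} → proj₁ p ∧ proj₂ p ≡ true → ¬ Tr (p ∷ X)
¬Tr-incl {p = true , true} _ ()

Tr-l : ∀ {n} {X : Sub n} → Tr X → l X ≡ n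
Tr-l []     = refl
Tr-l (x∷ t) = cong suc (Tr-l t)
Tr-l (y∷ t) = cong suc (Tr-l t)

Tr-rn : ∀ {n} {X : Sub n} → Tr X → rn X ≡ n
Tr-rn t rewrite Tr-noIncl t = Tr-card t

-- g(X) = l(X) + [X includes some L_i].  Its truncation at n is r_n.
g : ∀ {n} → Sub n → ℕ
g X = l X + b2n (anyIncl X)

l≤n : ∀ {n} (X : Sub n) → l X ≤ n
l≤n []            = z≤n
l≤n ((a , b) ∷ X) = +-mono-≤ (b2n≤1 (a ∨ b)) (l≤n X)

allMeet⇒l≡n : ∀ {n} (X : Sub n) → allMeet X ≡ true → l X ≡ n
allMeet⇒l≡n []                    e = refl
allMeet⇒l≡n ((true , b) ∷ X)      e = cong suc (allMeet⇒l≡n X e)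
allMeet⇒l≡n ((false , true) ∷ X)  e = cong suc (allMeet⇒l≡n X e)

¬allMeet⇒l<n : ∀ {n} (X : Sub n) → allMeet X ≡ false → l X < n
¬allMeet⇒l<n ((true , b) ∷ X)      e = s≤s (¬allMeet⇒l<n X e)
¬allMeet⇒l<n ((false , true) ∷ X)  e = s≤s (¬allMeet⇒l<n X e)
¬allMeet⇒l<n ((false , false) ∷ X) e = s≤s (l≤n X)

noIncl⇒card≡l : ∀ {n} (X : Sub n) → anyIncl X ≡ false → card X ≡ l X
noIncl⇒card≡l []                    e = refl
noIncl⇒card≡l ((true , false) ∷ X)  e = cong suc (noIncl⇒card≡l X e)
noIncl⇒card≡l ((false , true) ∷ X)  e = cong suc (noIncl⇒card≡l X e)
noIncl⇒card≡l ((false , false) ∷ X) e = noIncl⇒card≡l X e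

rn≡n⊓g : ∀ {n} (X : Sub n) → rn X ≡ n ⊓ g X
rn≡n⊓g {n} X with anyIncl X in noIncl
... | false = begin
  card X          ≡⟨ noIncl⇒card≡l X noIncl ⟩
  l X             ≡⟨ m≥n⇒m⊓n≡n (l≤n X) ⟨
  n ⊓ l X         ≡⟨ cong (n ⊓_) (+-identityʳ (l X)) ⟨
  n ⊓ (l X + 0)   ∎
  where open ≡-Reasoning
... | true with allMeet X in meets
...   | true  = sym (m≤n⇒m⊓n≡m (subst (λ k → n ≤ k + 1) (sym (allMeet⇒l≡n X meets)) (m≤m+n n 1)))
...   | false = trans (sym (m≥n⇒m⊓n≡n (¬allMeet⇒l<n X meets))) (cong (n ⊓_) (+-comm 1 (l X)))

-- g is monotone: enlarging X can only create new met or included L_i.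
l-∪ : ∀ {n} (X Z : Sub n) → l X ≤ l (X ∪ Z)
l-∪ []                    []            = z≤n
l-∪ ((true , b) ∷ X)      (_ ∷ Z)       = s≤s (l-∪ X Z)
l-∪ ((false , true) ∷ X)  ((c , d) ∷ Z) rewrite ∨-zeroʳ c = s≤s (l-∪ X Z)
l-∪ ((false , false) ∷ X) (q ∷ Z)       = ≤-trans (l-∪ X Z) (m≤n+m _ _)

anyIncl-∪ : ∀ {n} (X Z : Sub n) → anyIncl X ≡ true → anyIncl (X ∪ Z) ≡ true
anyIncl-∪ ((true , true) ∷ X)   (_ ∷ Z)       e = refl
anyIncl-∪ ((true , false) ∷ X)  ((c , d) ∷ Z) e = ∨-introʳ d (anyIncl-∪ X Z e)
anyIncl-∪ ((false , true) ∷ X)  ((c , d) ∷ Z) e = ∨-introʳ (c ∧ true) (anyIncl-∪ X Z e)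
anyIncl-∪ ((false , false) ∷ X) ((c , d) ∷ Z) e = ∨-introʳ (c ∧ d) (anyIncl-∪ X Z e)

anyIncl-mono : ∀ {n} {X Y : Sub n} → X ∪ Y ≡ Y → anyIncl X ≡ true → anyIncl Y ≡ true
anyIncl-mono {X = X} {Y} X⊑Y e = subst (λ Z → anyIncl Z ≡ true) X⊑Y (anyIncl-∪ X Y e)

g-∪ : ∀ {n} (X Z : Sub n) → g X ≤ g (X ∪ Z)
g-∪ X Z = +-mono-≤ (l-∪ X Z) (b2n-mono (anyIncl-∪ X Z))

g-mono : ∀ {n} {X Y : Sub n} → X ∪ Y ≡ Y → g X ≤ g Y
g-mono {X = X} {Y} X⊑Y = subst (λ Z → g X ≤ g Z) X⊑Y (g-∪ X Y)

∩⊑ˡ : ∀ {n} (X Y : Sub n) → (X ∩ Y) ∪ X ≡ X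
∩⊑ˡ X Y = trans (∪-comm (X ∩ Y) X) (∪-absorbs-∩ X Y)

∩⊑ʳ : ∀ {n} (X Y : Sub n) → (X ∩ Y) ∪ Y ≡ Y
∩⊑ʳ X Y = subst (λ Z → Z ∪ Y ≡ Y) (∩-comm Y X) (∩⊑ˡ Y X)

-- cross X Y counts the L_i met by both X and Y but not by X ∩ Y; it is
-- exactly the defect of l from being modular.
crossAt : Bool × Bool → Bool × Bool → ℕ
crossAt (a , b) (c , d) = b2n ((a ∨ b) ∧ (c ∨ d)) ∸ b2n ((a ∧ c) ∨ (b ∧ d))

cross : ∀ {n} → Sub n → Sub n → ℕ
cross []      []      = 0
cross (p ∷ X) (q ∷ Y) = crossAt p q + cross X Y

l-modular : ∀ {n} (X Y : Sub n) → l (X ∪ Y) + l (X ∩ Y) + cross X Y ≡ l X + l Y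
l-modular []            []            = refl
l-modular ((a , b) ∷ X) ((c , d) ∷ Y) = begin
  (u + l (X ∪ Y)) + (i + l (X ∩ Y)) + (k + cross X Y)
    ≡⟨ shuffle u (l (X ∪ Y)) i (l (X ∩ Y)) k (cross X Y) ⟩
  (u + i + k) + (l (X ∪ Y) + l (X ∩ Y) + cross X Y)
    ≡⟨ cong₂ _+_ (atCoordinate a b c d) (l-modular X Y) ⟩
  (b2n (a ∨ b) + b2n (c ∨ d)) + (l X + l Y)
    ≡⟨ +-interchange (b2n (a ∨ b)) (b2n (c ∨ d)) (l X) (l Y) ⟩
  (b2n (a ∨ b) + l X) + (b2n (c ∨ d) + l Y) ∎
  where
  open ≡-Reasoning
  u i k : ℕ
  u = b2n ((a ∨ c) ∨ (b ∨ d))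
  i = b2n ((a ∧ c) ∨ (b ∧ d))
  k = crossAt (a , b) (c , d)
  shuffle : ∀ a b c d e f → (a + b) + (c + d) + (e + f) ≡ (a + c + e) + (b + d + f)
  shuffle = solve-∀
  atCoordinate : ∀ a b c d → b2n ((a ∨ c) ∨ (b ∨ d)) + b2n ((a ∧ c) ∨ (b ∧ d)) + crossAt (a , b) (c , d)
                           ≡ b2n (a ∨ b) + b2n (c ∨ d)
  atCoordinate true  b     true  d     = refl
  atCoordinate true  true  false true  = refl
  atCoordinate true  true  false false = refl
  atCoordinate true  false false true  = refl
  atCoordinate true  false false false = refl
  atCoordinate false true  true  true  = refl
  atCoordinate false true  true  false = refl
  atCoordinate false true  false true  = refl
  atCoordinate false true  false false = refl
  atCoordinate false false true  true  = refl
  atCoordinate false false true  false = refl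
  atCoordinate false false false true  = refl
  atCoordinate false false false false = refl

InclSplit : ∀ {n} → Sub n → Sub n → Set
InclSplit X Y = anyIncl X ≡ true ⊎ anyIncl Y ≡ true ⊎ 1 ≤ cross X Y

incl-∪-split : ∀ {n} (X Y : Sub n) → anyIncl (X ∪ Y) ≡ true → InclSplit X Y
incl-∪-split []            []            ()
incl-∪-split ((a , b) ∷ X) ((c , d) ∷ Y) e with ∨-elim ((a ∨ c) ∧ (b ∨ d)) e
... | inj₁ atHead = lift (atCoordinate a b c d atHead)
  where
  lift : (a ∧ b ≡ true ⊎ c ∧ d ≡ true ⊎ 1 ≤ crossAt (a , b) (c , d)) → InclSplit ((a , b) ∷ X) ((c , d) ∷ Y)
  lift (inj₁ inclX)         = inj₁ (∨-introˡ (anyIncl X) inclX)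
  lift (inj₂ (inj₁ inclY))  = inj₂ (inj₁ (∨-introˡ (anyIncl Y) inclY))
  lift (inj₂ (inj₂ crosses)) = inj₂ (inj₂ (≤-trans crosses (m≤m+n _ (cross X Y))))
  atCoordinate : ∀ a b c d → (a ∨ c) ∧ (b ∨ d) ≡ true →
                 a ∧ b ≡ true ⊎ c ∧ d ≡ true ⊎ 1 ≤ crossAt (a , b) (c , d)
  atCoordinate true  true  c     d     e = inj₁ refl
  atCoordinate a     b     true  true  e = inj₂ (inj₁ refl)
  atCoordinate true  false false true  e = inj₂ (inj₂ (s≤s z≤n))
  atCoordinate false true  true  false e = inj₂ (inj₂ (s≤s z≤n))
... | inj₂ inRest with incl-∪-split X Y inRest
...   | inj₁ inclX           = inj₁ (∨-introʳ (a ∧ b) inclX)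
...   | inj₂ (inj₁ inclY)    = inj₂ (inj₁ (∨-introʳ (c ∧ d) inclY))
...   | inj₂ (inj₂ crosses)  = inj₂ (inj₂ (≤-trans crosses (m≤n+m _ (crossAt (a , b) (c , d)))))

incl-submod : ∀ {n} (X Y : Sub n) →
  b2n (anyIncl (X ∪ Y)) + b2n (anyIncl (X ∩ Y)) ≤ b2n (anyIncl X) + b2n (anyIncl Y) + cross X Y
incl-submod X Y = combine (anyIncl (X ∪ Y)) (anyIncl (X ∩ Y)) (anyIncl X) (anyIncl Y)
  (λ e → anyIncl-mono (∩⊑ˡ X Y) e , anyIncl-mono (∩⊑ʳ X Y) e) (incl-∪-split X Y)
  where
  combine : ∀ u i x y {s} → (i ≡ true → x ≡ true × y ≡ true) →
            (u ≡ true → x ≡ true ⊎ y ≡ true ⊎ 1 ≤ s) → b2n u + b2n i ≤ b2n x + b2n y + s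
  combine u     true  x y {s} both _ with both refl
  ... | refl , refl = ≤-trans (+-monoˡ-≤ 1 (b2n≤1 u)) (m≤m+n 2 s)
  combine false false x y       _ _ = z≤n
  combine true  false x y {s}   _ split with split refl
  ... | inj₁ refl         = s≤s z≤n
  ... | inj₂ (inj₁ refl)  = ≤-trans (m≤n+m 1 (b2n x)) (m≤m+n (b2n x + 1) s)
  ... | inj₂ (inj₂ 1≤s)   = ≤-trans 1≤s (m≤n+m s (b2n x + b2n y))

g-submod : ∀ {n} (X Y : Sub n) → g (X ∪ Y) + g (X ∩ Y) ≤ g X + g Y
g-submod X Y = begin
  (lU + iU) + (lI + iI)        ≡⟨ +-interchange lU iU lI iI ⟩
  (lU + lI) + (iU + iI)        ≤⟨ +-monoʳ-≤ (lU + lI) (incl-submod X Y) ⟩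
  (lU + lI) + (iX + iY + k)    ≡⟨ regroup lU lI iX iY k ⟩
  (lU + lI + k) + (iX + iY)    ≡⟨ cong (_+ (iX + iY)) (l-modular X Y) ⟩
  (l X + l Y) + (iX + iY)      ≡⟨ +-interchange (l X) (l Y) iX iY ⟩
  (l X + iX) + (l Y + iY)      ∎
  where
  open ≤-Reasoning
  lU lI iU iI iX iY k : ℕ
  lU = l (X ∪ Y)
  lI = l (X ∩ Y)
  iU = b2n (anyIncl (X ∪ Y))
  iI = b2n (anyIncl (X ∩ Y))
  iX = b2n (anyIncl X)
  iY = b2n (anyIncl Y)
  k = cross X Y
  regroup : ∀ a b c d e → (a + b) + (c + d + e) ≡ (a + b + e) + (c + d)
  regroup = solve-∀

l≤card : ∀ {n} (X : Sub n) → l X ≤ card X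
l≤card []                    = z≤n
l≤card ((true , true) ∷ X)   = s≤s (≤-trans (l≤card X) (n≤1+n _))
l≤card ((true , false) ∷ X)  = s≤s (l≤card X)
l≤card ((false , true) ∷ X)  = s≤s (l≤card X)
l≤card ((false , false) ∷ X) = l≤card X

-- An included L_i contributes two elements to |X| but one to l(X).
g≤card : ∀ {n} (X : Sub n) → g X ≤ card X
g≤card []                    = z≤n
g≤card ((true , true) ∷ X)   = s≤s (subst (_≤ suc (card X)) (+-comm 1 (l X)) (s≤s (l≤card X)))
g≤card ((true , false) ∷ X)  = s≤s (g≤card X)
g≤card ((false , true) ∷ X)  = s≤s (g≤card X)
g≤card ((false , false) ∷ X) = g≤card X

⊓-submod : ∀ n {a b c d} → a + b ≤ c + d → b ≤ c → b ≤ d → c ≤ a → d ≤ a →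
           n ⊓ a + n ⊓ b ≤ n ⊓ c + n ⊓ d
⊓-submod n {a} {b} {c} {d} ab≤cd b≤c b≤d c≤a d≤a with n ≤? c | n ≤? d
... | yes n≤c | _ rewrite m≤n⇒m⊓n≡m n≤c = +-mono-≤ (m⊓n≤m n a) (⊓-monoʳ-≤ n b≤d)
... | no _ | yes n≤d rewrite m≤n⇒m⊓n≡m n≤d =
  subst (n ⊓ a + n ⊓ b ≤_) (+-comm n (n ⊓ c)) (+-mono-≤ (m⊓n≤m n a) (⊓-monoʳ-≤ n b≤c))
... | no n≰c | no n≰d rewrite m≥n⇒m⊓n≡n (<⇒≤ (≰⇒> n≰c)) | m≥n⇒m⊓n≡n (<⇒≤ (≰⇒> n≰d)) =
  ≤-trans (+-mono-≤ (m⊓n≤n n a) (m⊓n≤n n b)) ab≤cd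

rn-submod : ∀ {n} (X Y : Sub n) → rn (X ∪ Y) + rn (X ∩ Y) ≤ rn X + rn Y
rn-submod {n} X Y rewrite rn≡n⊓g (X ∪ Y) | rn≡n⊓g (X ∩ Y) | rn≡n⊓g X | rn≡n⊓g Y =
  ⊓-submod n (g-submod X Y) (g-mono (∩⊑ˡ X Y)) (g-mono (∩⊑ʳ X Y))
             (g-∪ X Y) (subst (λ Z → g Y ≤ g Z) (∪-comm Y X) (g-∪ Y X))

rn≤n : ∀ {n} (X : Sub n) → rn X ≤ n
rn≤n {n} X rewrite rn≡n⊓g X = m⊓n≤m n (g X)

rn≤card : ∀ {n} (X : Sub n) → rn X ≤ card X
rn≤card {n} X rewrite rn≡n⊓g X = ≤-trans (m⊓n≤n n (g X)) (g≤card X)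

rn-mono : ∀ {n} (X Y : Sub n) → X ⊆ Y → rn X ≤ rn Y
rn-mono {n} X Y X⊆Y rewrite rn≡n⊓g X | rn≡n⊓g Y = ⊓-monoʳ-≤ n (g-mono (⊆⇒∪≡ X Y X⊆Y))

l-∩ʳ : ∀ {n} (X Y : Sub n) → l (X ∩ Y) ≤ l Y
l-∩ʳ X Y = subst (λ Z → l (X ∩ Y) ≤ l Z) (∩⊑ʳ X Y) (l-∪ (X ∩ Y) Y)

Tr-∩-noIncl : ∀ {n} {X : Sub n} → Tr X → (Y : Sub n) → anyIncl (X ∩ Y) ≡ false
Tr-∩-noIncl {X = X} t Y = ¬-not (λ incl → true≢false (trans (sym (anyIncl-mono (∩⊑ˡ X Y) incl)) (Tr-noIncl t)))

rn-Tr-∩ : ∀ {n} {X : Sub n} → Tr X → (Y : Sub n) → rn (X ∩ Y) ≡ l (X ∩ Y)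
rn-Tr-∩ {X = X} t Y rewrite Tr-∩-noIncl t Y = noIncl⇒card≡l (X ∩ Y) (Tr-∩-noIncl t Y)

Tr-∩-l : ∀ {n} {X Y : Sub n} → Tr X → Tr Y → l (X ∩ Y) + diffCount X Y ≡ n
Tr-∩-l []               []               = refl
Tr-∩-l (x∷ s)           (x∷ t)           = cong suc (Tr-∩-l s t)
Tr-∩-l (y∷ s)           (y∷ t)           = cong suc (Tr-∩-l s t)
Tr-∩-l {X = _ ∷ X} {_ ∷ Y} (x∷ s) (y∷ t) = trans (+-suc (l (X ∩ Y)) (diffCount X Y)) (cong suc (Tr-∩-l s t))
Tr-∩-l {X = _ ∷ X} {_ ∷ Y} (y∷ s) (x∷ t) = trans (+-suc (l (X ∩ Y)) (diffCount X Y)) (cong suc (Tr-∩-l s t))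

Tr-diff0 : ∀ {n} {X Y : Sub n} → Tr X → Tr Y → diffCount X Y ≡ 0 → X ≡ Y
Tr-diff0 []     []     _ = refl
Tr-diff0 (x∷ s) (x∷ t) e = cong (_ ∷_) (Tr-diff0 s t e)
Tr-diff0 (y∷ s) (y∷ t) e = cong (_ ∷_) (Tr-diff0 s t e)

Tr-∩-misses : ∀ {n} {X : Sub n} → Tr X → (Y : Sub n) → X ∩ Y ≡ X ⊎ l (X ∩ Y) < n
Tr-∩-misses []     []                   = inj₁ refl
Tr-∩-misses (x∷ t) ((true , d) ∷ Y)     with Tr-∩-misses t Y
... | inj₁ same  = inj₁ (cong (_ ∷_) same)
... | inj₂ short = inj₂ (s≤s short)
Tr-∩-misses {X = _ ∷ X} (x∷ t) ((false , d) ∷ Y) = inj₂ (s≤s (l≤n (X ∩ Y)))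
Tr-∩-misses (y∷ t) ((c , true) ∷ Y)     with Tr-∩-misses t Y
... | inj₁ same  = inj₁ (cong (_ ∷_) same)
... | inj₂ short = inj₂ (s≤s short)
Tr-∩-misses {X = _ ∷ X} (y∷ t) ((c , false) ∷ Y) = inj₂ (s≤s (l≤n (X ∩ Y)))

Tr-∪-exceeds : ∀ {n} {X : Sub n} → Tr X → (Y : Sub n) → X ∪ Y ≡ X ⊎ l (X ∩ Y) < g Y
Tr-∪-exceeds []     []                       = inj₁ refl
Tr-∪-exceeds (x∷ t) ((true , false) ∷ Y)     with Tr-∪-exceeds t Y
... | inj₁ same = inj₁ (cong (_ ∷_) same)
... | inj₂ less = inj₂ (s≤s less)
Tr-∪-exceeds (x∷ t) ((false , false) ∷ Y)    with Tr-∪-exceeds t Y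
... | inj₁ same = inj₁ (cong (_ ∷_) same)
... | inj₂ less = inj₂ less
Tr-∪-exceeds {X = _ ∷ X} (x∷ t) ((true , true) ∷ Y) =
  inj₂ (s≤s (subst (suc (l (X ∩ Y)) ≤_) (+-comm 1 (l Y)) (s≤s (l-∩ʳ X Y))))
Tr-∪-exceeds {X = _ ∷ X} (x∷ t) ((false , true) ∷ Y) = inj₂ (s≤s (≤-trans (l-∩ʳ X Y) (m≤m+n (l Y) _)))
Tr-∪-exceeds (y∷ t) ((false , true) ∷ Y)     with Tr-∪-exceeds t Y
... | inj₁ same = inj₁ (cong (_ ∷_) same)
... | inj₂ less = inj₂ (s≤s less)
Tr-∪-exceeds (y∷ t) ((false , false) ∷ Y)    with Tr-∪-exceeds t Y
... | inj₁ same = inj₁ (cong (_ ∷_) same)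
... | inj₂ less = inj₂ less
Tr-∪-exceeds {X = _ ∷ X} (y∷ t) ((true , true) ∷ Y) =
  inj₂ (s≤s (subst (suc (l (X ∩ Y)) ≤_) (+-comm 1 (l Y)) (s≤s (l-∩ʳ X Y))))
Tr-∪-exceeds {X = _ ∷ X} (y∷ t) ((true , false) ∷ Y) = inj₂ (s≤s (≤-trans (l-∩ʳ X Y) (m≤m+n (l Y) _)))

ind : ∀ {P : Set} → Dec P → ℕ
ind (yes _) = 1
ind (no _)  = 0

-- If x + a + b = n then (n − a) + (n − b) − n = x: the arithmetic of a
-- connectivity value on a set whose rank and co-rank are lowered by a, b.
conn-arith : ∀ x a b {n} → x + a + b ≡ n → (n ∸ a) + (n ∸ b) ∸ n ≡ x
conn-arith x a b refl = begin
  (s ∸ a) + (s ∸ b) ∸ s  ≡⟨ cong (λ t → t + (s ∸ b) ∸ s) (trans (cong (_∸ a) (swap x a b)) (m+n∸n≡m (x + b) a)) ⟩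
  (x + b) + (s ∸ b) ∸ s  ≡⟨ cong (λ t → (x + b) + t ∸ s) (m+n∸n≡m (x + a) b) ⟩
  (x + b) + (x + a) ∸ s  ≡⟨ cong (_∸ s) (gather x a b) ⟩
  x + s ∸ s              ≡⟨ m+n∸n≡m x s ⟩
  x                      ∎
  where
  open ≡-Reasoning
  s : ℕ
  s = x + a + b
  swap : ∀ x a b → x + a + b ≡ (x + b) + a
  swap = solve-∀
  gather : ∀ x a b → (x + b) + (x + a) ≡ x + (x + a + b)
  gather = solve-∀

allMeet-full : ∀ n → allMeet (full n) ≡ true
allMeet-full zero    = refl
allMeet-full (suc n) = allMeet-full n

-- Submodularity is the only real
-- issue; it is the inequality 'relaxed-submod' below, which compares the
-- loss [· ∈ D] on X, Y with the loss on X ∪ Y, X ∩ Y.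
module Relaxation {k : ℕ} (D : Sub (suc k) → Set) (D? : ∀ X → Dec (D X))
  (D⇒Tr : ∀ {X} → D X → Tr X) (D-indep : ∀ {X Y} → D X → D Y → diffCount X Y ≢ 1) where

  n : ℕ
  n = suc k

  Δ : Sub n → ℕ
  Δ X = ind (D? X)

  Δ-yes : ∀ {X} → D X → Δ X ≡ 1
  Δ-yes {X} dX with D? X
  ... | yes _   = refl
  ... | no ¬dX  = ⊥-elim (¬dX dX)

  Δ-no : ∀ {X} → ¬ D X → Δ X ≡ 0
  Δ-no {X} ¬dX with D? X
  ... | yes dX = ⊥-elim (¬dX dX)
  ... | no _   = refl

  r : Sub n → ℕ
  r X = rn X ∸ Δ X

  r+Δ : ∀ X → r X + Δ X ≡ rn X
  r+Δ X with D? X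
  ... | no _   = +-identityʳ (rn X)
  ... | yes dX = m∸n+n≡m (subst (1 ≤_) (sym (Tr-rn (D⇒Tr dX))) (s≤s z≤n))

  -- X ∈ D, Y ∉ D: the unit lost on X is regained on X ∪ Y or X ∩ Y, or
  -- r_n itself has a unit of slack.
  mixed-submod : ∀ X Y → D X → rn (X ∪ Y) + rn (X ∩ Y) + 1 ≤ rn X + rn Y + (Δ (X ∪ Y) + Δ (X ∩ Y))
  mixed-submod X Y dX with Tr-∪-exceeds (D⇒Tr dX) Y | Tr-∩-misses (D⇒Tr dX) Y
  ... | inj₁ U≡X | _ rewrite U≡X | Δ-yes dX =
    ≤-trans (+-monoˡ-≤ 1 (subst (λ Z → rn Z + rn (X ∩ Y) ≤ rn X + rn Y) U≡X (rn-submod X Y)))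
            (+-monoʳ-≤ (rn X + rn Y) (m≤m+n 1 _))
  ... | inj₂ _ | inj₁ I≡X rewrite I≡X | Δ-yes dX =
    ≤-trans (+-monoˡ-≤ 1 (subst (λ Z → rn (X ∪ Y) + rn Z ≤ rn X + rn Y) I≡X (rn-submod X Y)))
            (+-monoʳ-≤ (rn X + rn Y) (m≤n+m 1 (Δ (X ∪ Y))))
  ... | inj₂ I<gY | inj₂ I<n = ≤-trans slack (m≤m+n (rn X + rn Y) _)
    where
    slack : rn (X ∪ Y) + rn (X ∩ Y) + 1 ≤ rn X + rn Y
    slack rewrite rn-Tr-∩ (D⇒Tr dX) Y | Tr-rn (D⇒Tr dX) | +-assoc (rn (X ∪ Y)) (l (X ∩ Y)) 1
                | +-comm (l (X ∩ Y)) 1 | rn≡n⊓g Y =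
      +-mono-≤ (rn≤n (X ∪ Y)) (⊓-glb I<n I<gY)

  -- Two sets of D are at distance ≥ 2, so their intersection has rank
  -- ≤ n − 2 and pays for both lost units.
  relaxed-submod : ∀ X Y → rn (X ∪ Y) + rn (X ∩ Y) + (Δ X + Δ Y) ≤ rn X + rn Y + (Δ (X ∪ Y) + Δ (X ∩ Y))
  relaxed-submod X Y with D? X | D? Y
  ... | no _   | no _   = ≤-trans (≤-reflexive (+-identityʳ _)) (≤-trans (rn-submod X Y) (m≤m+n _ _))
  ... | yes dX | no _   = mixed-submod X Y dX
  ... | no _   | yes dY = begin
    rn (X ∪ Y) + rn (X ∩ Y) + 1             ≡⟨ cong₂ (λ U I → rn U + rn I + 1) (∪-comm X Y) (∩-comm X Y) ⟩
    rn (Y ∪ X) + rn (Y ∩ X) + 1             ≤⟨ mixed-submod Y X dY ⟩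
    rn Y + rn X + (Δ (Y ∪ X) + Δ (Y ∩ X))   ≡⟨ cong₂ _+_ (+-comm (rn Y) (rn X))
                                                  (cong₂ (λ U I → Δ U + Δ I) (∪-comm Y X) (∩-comm Y X)) ⟩
    rn X + rn Y + (Δ (X ∪ Y) + Δ (X ∩ Y))   ∎
    where open ≤-Reasoning
  ... | yes dX | yes dY with diffCount X Y in diff | Tr-∩-l (D⇒Tr dX) (D⇒Tr dY)
  ...   | 0 | _ rewrite Tr-diff0 (D⇒Tr dX) (D⇒Tr dY) diff | ∪-idem Y | ∩-idem Y | Δ-yes dY = ≤-refl
  ...   | 1 | _ = ⊥-elim (D-indep dX dY diff)
  ...   | suc (suc j) | lI+diff≡n = ≤-trans twoSlack (m≤m+n _ _)
    where
    twoSlack : rn (X ∪ Y) + rn (X ∩ Y) + 2 ≤ rn X + rn Y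
    twoSlack rewrite rn-Tr-∩ (D⇒Tr dX) Y | Tr-rn (D⇒Tr dX) | Tr-rn (D⇒Tr dY)
                   | +-assoc (rn (X ∪ Y)) (l (X ∩ Y)) 2 =
      +-mono-≤ (rn≤n (X ∪ Y)) (subst (l (X ∩ Y) + 2 ≤_) lI+diff≡n (+-monoʳ-≤ (l (X ∩ Y)) (s≤s (s≤s z≤n))))

  r-submod : ∀ X Y → r (X ∪ Y) + r (X ∩ Y) ≤ r X + r Y
  r-submod X Y = +-cancelʳ-≤ (ΔX + ΔY + (ΔU + ΔI)) _ _ (begin
    r U + r I + (ΔX + ΔY + (ΔU + ΔI))      ≡⟨ regroup (r U) (r I) ΔX ΔY ΔU ΔI ⟩
    (r U + ΔU) + (r I + ΔI) + (ΔX + ΔY)    ≡⟨ cong₂ (λ s t → s + t + (ΔX + ΔY)) (r+Δ U) (r+Δ I) ⟩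
    rn U + rn I + (ΔX + ΔY)                ≤⟨ relaxed-submod X Y ⟩
    rn X + rn Y + (ΔU + ΔI)                ≡⟨ cong₂ (λ s t → s + t + (ΔU + ΔI)) (r+Δ X) (r+Δ Y) ⟨
    (r X + ΔX) + (r Y + ΔY) + (ΔU + ΔI)    ≡⟨ regroup′ (r X) (r Y) ΔX ΔY ΔU ΔI ⟨
    r X + r Y + (ΔX + ΔY + (ΔU + ΔI))      ∎)
    where
    open ≤-Reasoning
    U I : Sub n
    U = X ∪ Y
    I = X ∩ Y
    ΔX ΔY ΔU ΔI : ℕ
    ΔX = Δ X
    ΔY = Δ Y
    ΔU = Δ U
    ΔI = Δ I
    regroup : ∀ a b c d e f → a + b + (c + d + (e + f)) ≡ (a + e) + (b + f) + (c + d)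
    regroup = solve-∀
    regroup′ : ∀ a b c d e f → a + b + (c + d + (e + f)) ≡ (a + c) + (b + d) + (e + f)
    regroup′ = solve-∀

  r-card : ∀ X → r X ≤ card X
  r-card X = ≤-trans (m∸n≤m (rn X) (Δ X)) (rn≤card X)

  -- The only delicate case: X ∉ D below Y ∈ D; then X ⊊ Y misses some L_i.
  r-mono : ∀ X Y → X ⊆ Y → r X ≤ r Y
  r-mono X Y X⊆Y with D? X | D? Y
  ... | no _   | no _   = rn-mono X Y X⊆Y
  ... | yes _  | yes _  = ∸-monoˡ-≤ 1 (rn-mono X Y X⊆Y)
  ... | yes _  | no _   = ≤-trans (m∸n≤m (rn X) 1) (rn-mono X Y X⊆Y)
  ... | no ¬dX | yes dY with Tr-∩-misses (D⇒Tr dY) X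
  ...   | inj₁ Y∩X≡Y = ⊥-elim (¬dX (subst D (trans (sym Y∩X≡Y) (⊆⇒∩≡ X Y X⊆Y)) dY))
  ...   | inj₂ short = begin
    rn X ∸ 0         ≡⟨ cong rn (⊆⇒∩≡ X Y X⊆Y) ⟨
    rn (Y ∩ X)       ≡⟨ rn-Tr-∩ (D⇒Tr dY) X ⟩
    l (Y ∩ X)        ≤⟨ s≤s⁻¹ short ⟩
    k                ≡⟨ cong (_∸ 1) (Tr-rn (D⇒Tr dY)) ⟨
    rn Y ∸ 1         ∎
    where open ≤-Reasoning

  M : Matroid n
  M = record { r = r ; r-card = r-card ; r-mono = r-mono ; r-submod = r-submod }

  -- E_n is not a transversal, so r(E_n) = r_n(E_n) = n.
  r-full : r (full n) ≡ n
  r-full rewrite Δ-no {full n} (λ d → ¬Tr-incl refl (D⇒Tr d)) | allMeet-full k = refl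

  -- Off the transversals nothing was relaxed, so μ_M agrees with λ_n.
  μ-off : ∀ X → ¬ Tr X → μ M X ≡ λn X
  μ-off X ¬tX rewrite r-full | Δ-no (λ d → ¬tX (D⇒Tr d))
                    | Δ-no {comp X} (λ d → ¬tX (subst Tr (comp-involutive X) (Tr-comp (D⇒Tr d)))) = refl

  μ-on : ∀ X → Tr X → ∀ x → x + Δ X + Δ (comp X) ≡ n → μ M X ≡ x
  μ-on X tX x sum rewrite r-full | Tr-rn tX | Tr-rn (Tr-comp tX) = conn-arith x (Δ X) (Δ (comp X)) sum

record Colouring {n} (λf : Sub n → ℕ) : Set where
  field
    colour : Sub n → Bool
    swap   : ∀ X → InG λf X → colour (comp X) ≡ not (colour X)
    proper : ∀ {X Y} → InG λf X → InG λf Y → Adj X Y → colour Y ≡ not (colour X)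

-- Such a colouring makes λ a connectivity function: relax the transversals
-- with λ = n − 2 and the vertices of G_λ of colour true.
module FromColouring {k : ℕ} (λf : Sub (suc (suc k)) → ℕ) (spiky : Spiky (suc (suc k)) λf)
  (colouring : Colouring λf) where

  open Spiky spiky
  open Colouring colouring

  D : Sub (suc (suc k)) → Set
  D X = Tr X × (λf X ≡ k ⊎ (λf X ≡ suc k × colour X ≡ true))

  D? : ∀ X → Dec (D X)
  D? X = tr? X ×-dec (λf X ≟ k ⊎-dec (λf X ≟ suc k ×-dec colour X Bool.≟ true))

  D-low : ∀ {X} → D X → λf X ≤ suc k
  D-low (_ , inj₁ λ≡k)       = ≤-trans (≤-reflexive λ≡k) (n≤1+n k)
  D-low (_ , inj₂ (λ≡1+k , _)) = ≤-reflexive λ≡1+k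

  -- Adjacent transversals have λ-values summing to at least 2k + 2, so two
  -- of them in D both have λ = k + 1, and then the colouring separates them.
  D-indep : ∀ {X Y} → D X → D Y → diffCount X Y ≢ 1
  D-indep {X} {Y} dX dY d≡1 = contradiction (adjacent X Y adj) (separated dX dY)
    where
    adj : Adj X Y
    adj = Tr⇒Transversal (proj₁ dX) , Tr⇒Transversal (proj₁ dY) , d≡1
    tooSmall : ∀ {a b} → a ≡ k → b ≤ suc k → ¬ (suc (suc k) + suc (suc k) ∸ 2 ≤ a + b)
    tooSmall refl b≤ big = <⇒≱ (+-monoʳ-< k (s≤s b≤)) big
    separated : D X → D Y → ¬ (suc (suc k) + suc (suc k) ∸ 2 ≤ λf X + λf Y)
    separated (_ , inj₁ λX≡k) dY = tooSmall λX≡k (D-low dY)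
    separated dX (_ , inj₁ λY≡k) = tooSmall λY≡k (D-low dX) ∘ subst (k + suc (suc k) ≤_) (+-comm (λf X) (λf Y))
    separated (tX , inj₂ (λX , cX)) (tY , inj₂ (λY , cY)) _ =
      true≢false (trans (sym cY) (trans (proper (Tr⇒Transversal tX , λX) (Tr⇒Transversal tY , λY) adj) (cong not cX)))

  open Relaxation D D? proj₁ D-indep

  λ-comp : ∀ X → λf (comp X) ≡ λf X
  λ-comp X = sym (symmetric X)

  Δ-low : ∀ {X} → Tr X → λf X ≡ k → Δ X ≡ 1
  Δ-low tX λ≡k = Δ-yes (tX , inj₁ λ≡k)

  Δ-high : ∀ {X} → λf X ≡ suc (suc k) → Δ X ≡ 0
  Δ-high λ≡n = Δ-no λ
    { (_ , inj₁ λ≡k)         → <⇒≢ (s≤s (n≤1+n k)) (trans (sym λ≡k) λ≡n)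
    ; (_ , inj₂ (λ≡1+k , _)) → <⇒≢ (n<1+n (suc k)) (trans (sym λ≡1+k) λ≡n) }

  Δ-mid : ∀ {X} → Tr X → λf X ≡ suc k → Δ X ≡ b2n (colour X)
  Δ-mid {X} tX λ≡1+k = byColour (colour X) refl
    where
    byColour : ∀ c → colour X ≡ c → Δ X ≡ b2n c
    byColour true  c = Δ-yes (tX , inj₂ (λ≡1+k , c))
    byColour false c = Δ-no λ
      { (_ , inj₁ λ≡k)    → <⇒≢ (n<1+n k) (trans (sym λ≡k) λ≡1+k)
      ; (_ , inj₂ (_ , t)) → true≢false (trans (sym t) c) }

  λ+Δ : ∀ X → Tr X → λf X + Δ X + Δ (comp X) ≡ suc (suc k)
  λ+Δ X tX with values X (Tr⇒Transversal tX)
  ... | inj₁ λ≡k rewrite Δ-low tX λ≡k | Δ-low (Tr-comp tX) (trans (λ-comp X) λ≡k) | λ≡k =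
    trans (+-assoc k 1 1) (+-comm k 2)
  ... | inj₂ (inj₁ λ≡1+k) rewrite Δ-mid tX λ≡1+k | Δ-mid (Tr-comp tX) (trans (λ-comp X) λ≡1+k)
                                | swap X (Tr⇒Transversal tX , λ≡1+k) | λ≡1+k = oneOfTwo (colour X)
    where
    oneOfTwo : ∀ c → suc k + b2n c + b2n (not c) ≡ suc (suc k)
    oneOfTwo true  = cong suc (trans (+-identityʳ (k + 1)) (+-comm k 1))
    oneOfTwo false = cong suc (trans (cong (_+ 1) (+-identityʳ k)) (+-comm k 1))
  ... | inj₂ (inj₂ λ≡n) rewrite Δ-high λ≡n | Δ-high (trans (λ-comp X) λ≡n) | λ≡n =
    trans (+-identityʳ _) (+-identityʳ _)

  isConnFn : IsConnFn λf
  isConnFn = M , λ X → agree X (tr? X)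
    where
    agree : ∀ X → Dec (Tr X) → λf X ≡ μ M X
    agree X (yes tX) = sym (μ-on X tX (λf X) (λ+Δ X tX))
    agree X (no ¬tX) = trans (agrees X (¬tX ∘ Transversal⇒Tr X)) (sym (μ-off X ¬tX))

parity : ∀ {n} → Sub n → Bool
parity []            = false
parity ((a , b) ∷ X) = a xor parity X

odd : ℕ → Bool
odd zero    = false
odd (suc n) = not (odd n)

%2≡odd : ∀ n → n % 2 ≡ b2n (odd n)
%2≡odd zero          = refl
%2≡odd (suc zero)    = refl
%2≡odd (suc (suc n)) = begin
  (2 + n) % 2           ≡⟨ cong (_% 2) (+-comm 2 n) ⟩
  (n + 2) % 2           ≡⟨ [m+n]%n≡m%n n 2 ⟩
  n % 2                 ≡⟨ %2≡odd n ⟩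
  b2n (odd n)           ≡⟨ cong b2n (not-involutive (odd n)) ⟨
  b2n (odd (2 + n))     ∎
  where open ≡-Reasoning

parity-comp : ∀ {n} (X : Sub n) → parity (comp X) ≡ parity X xor odd n
parity-comp []                         = refl
parity-comp {suc n} ((a , b) ∷ X) = begin
  not a xor parity (comp X)        ≡⟨ cong (not a xor_) (parity-comp X) ⟩
  not a xor (parity X xor odd n)   ≡⟨ not-distribˡ-xor a _ ⟨
  not (a xor (parity X xor odd n)) ≡⟨ cong not (xor-assoc a (parity X) (odd n)) ⟨
  not ((a xor parity X) xor odd n) ≡⟨ not-distribʳ-xor (a xor parity X) (odd n) ⟩
  (a xor parity X) xor not (odd n) ∎
  where open ≡-Reasoning

parity-diff : ∀ {n} {X Y : Sub n} → Tr X → Tr Y → parity X xor parity Y ≡ odd (diffCount X Y)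
parity-diff []     []     = refl
parity-diff {X = _ ∷ X} {_ ∷ Y} (x∷ s) (x∷ t) =
  trans (not-xor-not (parity X) (parity Y)) (parity-diff s t)
parity-diff (y∷ s) (y∷ t) = parity-diff s t
parity-diff {X = _ ∷ X} {_ ∷ Y} (x∷ s) (y∷ t) =
  trans (sym (not-distribˡ-xor (parity X) (parity Y))) (cong not (parity-diff s t))
parity-diff {X = _ ∷ X} {_ ∷ Y} (y∷ s) (x∷ t) =
  trans (sym (not-distribʳ-xor (parity X) (parity Y))) (cong not (parity-diff s t))

parity-adj : ∀ {n} {X Y : Sub n} → Adj X Y → parity Y ≡ not (parity X)
parity-adj {X = X} {Y} (tX , tY , d≡1) =
  xor≡true (trans (parity-diff (Transversal⇒Tr X tX) (Transversal⇒Tr Y tY)) (cong odd d≡1))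
  where
  xor≡true : ∀ {p q} → p xor q ≡ true → q ≡ not p
  xor≡true {true}  {false} _ = refl
  xor≡true {false} {true}  _ = refl

parityColouring : ∀ {n} (λf : Sub n → ℕ) → odd n ≡ true → Colouring λf
parityColouring λf n-odd = record
  { colour = parity
  ; swap   = λ X _ → trans (parity-comp X) (trans (cong (parity X xor_) n-odd) (xor-comm (parity X) true))
  ; proper = λ {X} {Y} _ _ adj → parity-adj {X = X} {Y} adj
  }

diff-sym : ∀ {n} (X Y : Sub n) → diffCount X Y ≡ diffCount Y X
diff-sym []            []            = refl
diff-sym ((a , b) ∷ X) ((c , d) ∷ Y) =
  cong₂ _+_ (cong₂ (λ s t → b2n (s ∨ t)) (xor-comm a c) (xor-comm b d)) (diff-sym X Y)

diff-comp : ∀ {n} (X Y : Sub n) → diffCount (comp X) (comp Y) ≡ diffCount X Y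
diff-comp []            []            = refl
diff-comp ((a , b) ∷ X) ((c , d) ∷ Y) =
  cong₂ _+_ (cong₂ (λ s t → b2n (s ∨ t)) (not-xor-not a c) (not-xor-not b d)) (diff-comp X Y)

adj-sym : ∀ {n} {X Y : Sub n} → Adj X Y → Adj Y X
adj-sym {X = X} {Y} (tX , tY , d≡1) = tY , tX , trans (diff-sym Y X) d≡1

adj-comp : ∀ {n} {X Y : Sub n} → Adj X Y → Adj (comp X) (comp Y)
adj-comp {X = X} {Y} (tX , tY , d≡1) =
  Tr⇒Transversal (Tr-comp (Transversal⇒Tr X tX)) , Tr⇒Transversal (Tr-comp (Transversal⇒Tr Y tY)) ,
  trans (diff-comp X Y) d≡1

allPairs : List (Bool × Bool)
allPairs = (true , true) ∷ᴸ (true , false) ∷ᴸ (false , true) ∷ᴸ (false , false) ∷ᴸ []ᴸ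

allSub : ∀ n → List (Sub n)
allSub zero    = [] ∷ᴸ []ᴸ
allSub (suc n) = cartesianProductWith _∷_ allPairs (allSub n)

∈-allSub : ∀ {n} (X : Sub n) → X ∈ allSub n
∈-allSub []      = here refl
∈-allSub (p ∷ X) = ∈-cartesianProductWith⁺ _∷_ (∈-allPairs p) (∈-allSub X)
  where
  ∈-allPairs : ∀ p → p ∈ allPairs
  ∈-allPairs (true , true)   = here refl
  ∈-allPairs (true , false)  = there (here refl)
  ∈-allPairs (false , true)  = there (there (here refl))
  ∈-allPairs (false , false) = there (there (there (here refl)))

module Walks {n : ℕ} (λf : Sub n → ℕ) where

  reach-start : ∀ {X Y} → Reach λf X Y → InG λf X
  reach-start (here v)     = v
  reach-start (step v _ _) = v

  reach-trans : ∀ {X Y Z} → Reach λf X Y → Reach λf Y Z → Reach λf X Z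
  reach-trans (here _)     w′ = w′
  reach-trans (step v a w) w′ = step v a (reach-trans w w′)

  reach-sym : ∀ {X Y} → Reach λf X Y → Reach λf Y X
  reach-sym (here v)     = here v
  reach-sym (step {X} {Y} v a w) = reach-trans (reach-sym w) (step (reach-start w) (adj-sym {X = X} {Y} a) (here v))

  reach-comp : (∀ X → λf X ≡ λf (comp X)) → ∀ {X Y} → Reach λf X Y → Reach λf (comp X) (comp Y)
  reach-comp sym-λ = go
    where
    inG-comp : ∀ {X} → InG λf X → InG λf (comp X)
    inG-comp {X} (tX , λ≡) = Tr⇒Transversal (Tr-comp (Transversal⇒Tr X tX)) , trans (sym (sym-λ X)) λ≡
    go : ∀ {X Y} → Reach λf X Y → Reach λf (comp X) (comp Y)
    go (here v)     = here (inG-comp v)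
    go (step {X} {Y} v a w) = step (inG-comp v) (adj-comp {X = X} {Y} a) (go w)

  -- Reachability in G_λ is decidable, by the Floyd–Warshall recursion over
  -- an enumeration of all subsets: Via L X Y says that X and Y are joined
  -- by a walk whose interior vertices lie in L.
  transversal? : ∀ (X : Sub n) → Dec (Transversal X)
  transversal? X = map′ (Tr⇒Transversal {X = X}) (Transversal⇒Tr X) (tr? X)

  inG? : ∀ X → Dec (InG λf X)
  inG? X = transversal? X ×-dec (λf X ≟ n ∸ 1)

  adj? : ∀ (X Y : Sub n) → Dec (Adj X Y)
  adj? X Y = transversal? X ×-dec transversal? Y ×-dec (diffCount X Y ≟ 1)

  Step : Sub n → Sub n → Set
  Step X Y = InG λf X × InG λf Y × (X ≡ Y ⊎ Adj X Y)

  step? : ∀ X Y → Dec (Step X Y)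
  step? X Y = inG? X ×-dec inG? Y ×-dec (≡-dec (×-≡-dec Bool._≟_ Bool._≟_) X Y ⊎-dec adj? X Y)

  Via : List (Sub n) → Sub n → Sub n → Set
  Via []ᴸ      X Y = Step X Y
  Via (v ∷ᴸ L) X Y = Via L X Y ⊎ (Via L X v × Via L v Y)

  via? : ∀ L X Y → Dec (Via L X Y)
  via? []ᴸ      X Y = step? X Y
  via? (v ∷ᴸ L) X Y = via? L X Y ⊎-dec (via? L X v ×-dec via? L v Y)

  via⇒reach : ∀ L {X Y} → Via L X Y → Reach λf X Y
  via⇒reach []ᴸ      (vX , vY , inj₁ refl) = here vY
  via⇒reach []ᴸ      (vX , vY , inj₂ a)    = step vX a (here vY)
  via⇒reach (v ∷ᴸ L) (inj₁ w)              = via⇒reach L w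
  via⇒reach (v ∷ᴸ L) (inj₂ (w , w′))       = reach-trans (via⇒reach L w) (via⇒reach L w′)

  step⇒via : ∀ L {X Y} → Step X Y → Via L X Y
  step⇒via []ᴸ      s = s
  step⇒via (v ∷ᴸ L) s = inj₁ (step⇒via L s)

  via-trans : ∀ L {X v Y} → v ∈ L → Via L X v → Via L v Y → Via L X Y
  via-trans (w ∷ᴸ L) (here refl) w₁ w₂ = inj₂ (toW w₁ , fromW w₂)
    where
    toW : ∀ {X} → Via (w ∷ᴸ L) X w → Via L X w
    toW (inj₁ p)       = p
    toW (inj₂ (p , _)) = p
    fromW : ∀ {Y} → Via (w ∷ᴸ L) w Y → Via L w Y
    fromW (inj₁ p)       = p
    fromW (inj₂ (_ , p)) = p
  via-trans (w ∷ᴸ L) (there v∈L) (inj₁ p)       (inj₁ q)       = inj₁ (via-trans L v∈L p q)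
  via-trans (w ∷ᴸ L) (there v∈L) (inj₁ p)       (inj₂ (q , q′)) = inj₂ (via-trans L v∈L p q , q′)
  via-trans (w ∷ᴸ L) (there v∈L) (inj₂ (p , p′)) (inj₁ q)       = inj₂ (p , via-trans L v∈L p′ q)
  via-trans (w ∷ᴸ L) (there v∈L) (inj₂ (p , _)) (inj₂ (_ , q′)) = inj₂ (p , q′)

  reach⇒via : ∀ {X Y} → Reach λf X Y → Via (allSub n) X Y
  reach⇒via (here v)             = step⇒via (allSub n) (v , v , inj₁ refl)
  reach⇒via (step {Y = Y} v a w) =
    via-trans (allSub n) (∈-allSub Y) (step⇒via (allSub n) (v , reach-start w , inj₂ a)) (reach⇒via w)

  reach? : ∀ X Y → Dec (Reach λf X Y)
  reach? X Y = map′ (via⇒reach (allSub n)) reach⇒via (via? (allSub n) X Y)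

firstIsP : ∀ {A : Set} {P Q : A → Set} → (∀ a → Dec (P a)) → (∀ a → Dec (Q a)) → List A → Bool
firstIsP P? Q? []ᴸ      = false
firstIsP P? Q? (a ∷ᴸ L) = if does (P? a) then true else if does (Q? a) then false else firstIsP P? Q? L

firstIsP-cong : ∀ {A : Set} {P Q P′ Q′ : A → Set}
  (P? : ∀ a → Dec (P a)) (Q? : ∀ a → Dec (Q a)) (P′? : ∀ a → Dec (P′ a)) (Q′? : ∀ a → Dec (Q′ a)) →
  (∀ a → P a ⇔ P′ a) → (∀ a → Q a ⇔ Q′ a) → ∀ L → firstIsP P? Q? L ≡ firstIsP P′? Q′? L
firstIsP-cong P? Q? P′? Q′? P⇔ Q⇔ []ᴸ      = refl
firstIsP-cong P? Q? P′? Q′? P⇔ Q⇔ (a ∷ᴸ L)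
  rewrite does-⇔ (P⇔ a) (P? a) (P′? a) | does-⇔ (Q⇔ a) (Q? a) (Q′? a)
        | firstIsP-cong P? Q? P′? Q′? P⇔ Q⇔ L = refl

firstIsP-swap : ∀ {A : Set} {P Q : A → Set} (P? : ∀ a → Dec (P a)) (Q? : ∀ a → Dec (Q a)) →
  (∀ a → P a → Q a → ⊥) → ∀ L → Any P L → firstIsP Q? P? L ≡ not (firstIsP P? Q? L)
firstIsP-swap P? Q? disjoint (a ∷ᴸ L) someP with P? a | Q? a
... | yes p  | yes q = ⊥-elim (disjoint a p q)
... | yes _  | no _  = refl
... | no _   | yes _ = refl
... | no ¬p  | no _  with someP
...   | here p     = ⊥-elim (¬p p)
...   | there rest = firstIsP-swap P? Q? disjoint L rest

-- For even n with no transversal reaching its complement: correct the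
-- parity by a side bit recording, for the pair of components C, E − C of
-- X and E − X, which of them is met first in the enumeration of subsets.
module ComponentColouring {n : ℕ} (λf : Sub n → ℕ) (symmetric : ∀ X → λf X ≡ λf (comp X))
  (n-even : odd n ≡ false) (noReach : ¬ ∃ (λ X → Transversal X × Reach λf X (comp X))) where

  open Walks λf

  side : Sub n → Bool
  side X = firstIsP (reach? X) (reach? (comp X)) (allSub n)

  side-reach : ∀ {X Y} → Reach λf X Y → side Y ≡ side X
  side-reach w = firstIsP-cong _ _ _ _ (λ v → mk⇔ (reach-trans w) (reach-trans (reach-sym w)))
    (λ v → mk⇔ (reach-trans w′) (reach-trans (reach-sym w′))) (allSub n)
    where w′ = reach-comp symmetric w

  -- A vertex and its complement lie in different components, hence the
  -- complement has the opposite side bit.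
  side-comp : ∀ {X} → InG λf X → side (comp X) ≡ not (side X)
  side-comp {X} vX = trans
    (firstIsP-cong _ _ _ _ (λ v → mk⇔ id id) (λ v → mk⇔ (subst (λ Z → Reach λf Z v) (comp-involutive X))
                                                     (subst (λ Z → Reach λf Z v) (sym (comp-involutive X))))
                   (allSub n))
    (firstIsP-swap (reach? X) (reach? (comp X)) separate (allSub n)
                   (Any.map (λ { refl → here vX }) (∈-allSub X)))
    where
    separate : ∀ v → Reach λf X v → Reach λf (comp X) v → ⊥
    separate v w w′ = noReach (X , proj₁ vX , reach-trans w (reach-sym w′))

  -- Parity xor side: the parity makes it proper, the side bit repairs the
  -- behaviour under complementation that the parity lacks for even n.
  colouring : Colouring λf
  colouring = record
    { colour = λ X → parity X xor side X
    ; swap   = λ X vX → begin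
        parity (comp X) xor side (comp X)   ≡⟨ cong₂ _xor_ (parity-comp X) (side-comp vX) ⟩
        (parity X xor odd n) xor not (side X) ≡⟨ cong (λ b → (parity X xor b) xor not (side X)) n-even ⟩
        (parity X xor false) xor not (side X) ≡⟨ cong (_xor not (side X)) (xor-identityʳ (parity X)) ⟩
        parity X xor not (side X)             ≡⟨ not-distribʳ-xor (parity X) (side X) ⟨
        not (parity X xor side X)             ∎
    ; proper = λ {X} {Y} vX vY adj → begin
        parity Y xor side Y                   ≡⟨ cong₂ _xor_ (parity-adj {X = X} {Y} adj) (side-reach (step vX adj (here vY))) ⟩
        not (parity X) xor side X             ≡⟨ not-distribˡ-xor (parity X) (side X) ⟨
        not (parity X xor side X)             ∎
    }
    where open ≡-Reasoning

Tr-∩-compMeets : ∀ {n} {X : Sub n} → Tr X → ∀ Y → allMeet (comp (X ∩ Y)) ≡ true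
Tr-∩-compMeets []     []            = refl
Tr-∩-compMeets (x∷ t) ((c , d) ∷ Y) rewrite ∨-zeroʳ (not c) = Tr-∩-compMeets t Y
Tr-∩-compMeets (y∷ t) ((c , d) ∷ Y) = Tr-∩-compMeets t Y

adj-∩-compIncl : ∀ {n} {X Y : Sub n} → Tr X → Tr Y → diffCount X Y ≡ 1 → anyIncl (comp (X ∩ Y)) ≡ true
adj-∩-compIncl []     []     ()
adj-∩-compIncl (x∷ s) (x∷ t) d = adj-∩-compIncl s t d
adj-∩-compIncl (y∷ s) (y∷ t) d = adj-∩-compIncl s t d
adj-∩-compIncl (x∷ s) (y∷ t) d = refl
adj-∩-compIncl (y∷ s) (x∷ t) d = refl

module AdjacentIntersection {m : ℕ} {X Y : Sub (suc m)} (tX : Tr X) (tY : Tr Y) (d≡1 : diffCount X Y ≡ 1) where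

  card-∩ : card (X ∩ Y) ≡ m
  card-∩ = trans (noIncl⇒card≡l (X ∩ Y) (Tr-∩-noIncl tX Y))
    (+-cancelʳ-≡ 1 _ m (trans (cong (l (X ∩ Y) +_) (sym d≡1)) (trans (Tr-∩-l tX tY) (+-comm 1 m))))

  ∩-notTr : ¬ Transversal (X ∩ Y)
  ∩-notTr t = <-irrefl (trans (sym card-∩) (Tr-card (Transversal⇒Tr (X ∩ Y) t))) (n<1+n m)

  λn-∩ : λn (X ∩ Y) ≡ m
  λn-∩ rewrite Tr-∩-noIncl tX Y | adj-∩-compIncl tX tY d≡1 | Tr-∩-compMeets tX Y | card-∩ =
    m+n∸n≡m m (suc m)

∸≡suc : ∀ a b {c} → a ∸ b ≡ suc c → a ≡ suc c + b
∸≡suc a b a∸b≡1+c =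
  trans (sym (m∸n+n≡m {a} {b} (<⇒≤ (m∸n≢0⇒n<m {a} {b} (λ a∸b≡0 → 1+n≢0 (trans (sym a∸b≡1+c) a∸b≡0))))))
        (cong (_+ b) a∸b≡1+c)

module Connectivity {n : ℕ} (M : Matroid n) where
  open Matroid M

  conn-sum : ∀ X {c} → μ M X ≡ suc c → r X + r (comp X) ≡ suc c + r (full n)
  conn-sum X = ∸≡suc (r X + r (comp X)) (r (full n))

  μ≤r : ∀ X → μ M X ≤ r X
  μ≤r X = begin
    r X + r (comp X) ∸ r (full n)   ≤⟨ ∸-monoˡ-≤ (r (full n)) (+-monoʳ-≤ (r X) (r-mono (comp X) (full n) (⊆full (comp X)))) ⟩
    r X + r (full n) ∸ r (full n)   ≡⟨ m+n∸n≡m (r X) (r (full n)) ⟩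
    r X                             ∎
    where open ≤-Reasoning

  rank-from-split : ∀ X {c} → n ≡ suc c → card X ≡ n → card (comp X) ≡ n → μ M X ≡ n → r (full n) ≡ n
  rank-from-split X refl |X| |E−X| μ≡n = ≤-antisym R≤n n≤R
    where
    sum : r X + r (comp X) ≡ n + r (full n)
    sum = conn-sum X μ≡n
    rX≤n : r X ≤ n
    rX≤n = subst (r X ≤_) |X| (r-card X)
    R≤n : r (full n) ≤ n
    R≤n = +-cancelˡ-≤ n _ _ (subst (_≤ n + n) sum (+-mono-≤ rX≤n (subst (r (comp X) ≤_) |E−X| (r-card (comp X)))))
    n≤rcX : n ≤ r (comp X)
    n≤rcX = +-cancelʳ-≤ (r (full n)) n (r (comp X))
      (subst (_≤ r (comp X) + r (full n)) sum
        (subst (r X + r (comp X) ≤_) (+-comm (r (full n)) (r (comp X)))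
          (+-monoˡ-≤ (r (comp X)) (r-mono X (full n) (⊆full X)))))
    n≤R : n ≤ r (full n)
    n≤R = ≤-trans n≤rcX (r-mono (comp X) (full n) (⊆full (comp X)))

-- If λ = μ_M then r(E) = n, and whether a vertex T
-- of G_λ spans M is a proper colouring of G_λ swapped by complementation.
-- Added to the parity it gives an invariant of the components of G_λ that
-- complementation negates, so no vertex reaches its complement.
module Necessity {k : ℕ} (λf : Sub (suc (suc k)) → ℕ) (spiky : Spiky (suc (suc k)) λf)
  (n-even : odd (suc (suc k)) ≡ false) (M : Matroid (suc (suc k))) (λ≡μ : ∀ X → λf X ≡ μ M X) where

  open Matroid M
  open Spiky spiky
  open Connectivity M
  open Walks λf

  n : ℕ
  n = suc (suc k)

  xs : ∀ j → Tr (replicate j (true , false))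
  xs zero    = []
  xs (suc j) = x∷ xs j

  -- Z = {x_1, y_1, x_3, …, x_n} has |Z| = |E − Z| = n and λ(Z) = n.
  Z : Sub n
  Z = (true , true) ∷ (false , false) ∷ replicate k (true , false)

  λn-Z : λn Z ≡ n
  λn-Z rewrite Tr-l (xs k) | Tr-l (Tr-comp (xs k)) = m+n∸n≡m n n

  r-full : r (full n) ≡ n
  r-full = rank-from-split Z refl (cong (suc ∘ suc) (Tr-card (xs k))) (cong (suc ∘ suc) (Tr-card (Tr-comp (xs k))))
    (trans (sym (λ≡μ Z)) (trans (agrees Z (¬Tr-incl refl ∘ Transversal⇒Tr Z)) λn-Z))

  r≤n : ∀ {T} → Tr T → r T ≤ n
  r≤n {T} tT = subst (r T ≤_) (Tr-card tT) (r-card T)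

  vertex-sum : ∀ {T} → InG λf T → r T + r (comp T) ≡ suc k + n
  vertex-sum {T} (_ , λ≡) = trans (conn-sum T (trans (sym (λ≡μ T)) λ≡)) (cong (suc k +_) r-full)

  -- Adjacent transversals T, T′: r(T ∪ T′) = n and r(T ∩ T′) ≥ n − 1.
  adj-sum : ∀ {T T′} → Adj T T′ → n + suc k ≤ r T + r T′
  adj-sum {T} {T′} (tT , tT′ , d≡1) = begin
    n + suc k                     ≤⟨ +-mono-≤ n≤rU (subst (_≤ r I) μI (μ≤r I)) ⟩
    r (T ∪ T′) + r (T ∩ T′)       ≤⟨ r-submod T T′ ⟩
    r T + r T′                    ∎
    where
    open ≤-Reasoning
    I U : Sub n
    I = T ∩ T′
    U = T ∪ T′
    t : Tr T
    t = Transversal⇒Tr T tT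
    t′ : Tr T′
    t′ = Transversal⇒Tr T′ tT′
    module Inner = AdjacentIntersection t t′ d≡1
    module Outer = AdjacentIntersection (Tr-comp t) (Tr-comp t′) (trans (diff-comp T T′) d≡1)
    μI : μ M I ≡ suc k
    μI = trans (sym (λ≡μ I)) (trans (agrees I Inner.∩-notTr) Inner.λn-∩)
    μU : μ M U ≡ suc k
    μU = begin-equality
      μ M U                      ≡⟨ λ≡μ U ⟨
      λf U                       ≡⟨ symmetric U ⟩
      λf (comp U)                ≡⟨ cong λf (comp-∪ T T′) ⟩
      λf (comp T ∩ comp T′)      ≡⟨ agrees _ Outer.∩-notTr ⟩
      λn (comp T ∩ comp T′)      ≡⟨ Outer.λn-∩ ⟩
      suc k                      ∎
    n≤rU : n ≤ r U
    n≤rU = +-cancelˡ-≤ (suc k) n (r U) (begin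
      suc k + n                  ≡⟨ cong (suc k +_) r-full ⟨
      suc k + r (full n)         ≡⟨ conn-sum U μU ⟨
      r U + r (comp U)           ≤⟨ +-monoʳ-≤ (r U) (subst (r (comp U) ≤_) (trans (cong card (comp-∪ T T′)) Outer.card-∩) (r-card (comp U))) ⟩
      r U + suc k                ≡⟨ +-comm (r U) (suc k) ⟩
      suc k + r U                ∎)

  vertex-Tr : ∀ {T} → InG λf T → Tr T
  vertex-Tr {T} vT = Transversal⇒Tr T (proj₁ vT)

  spans : Sub n → Bool
  spans T = does (r T ≟ n)

  nonspanning : ∀ {T} → Tr T → r T ≢ n → r T ≤ suc k
  nonspanning tT r≢n = s≤s⁻¹ (≤∧≢⇒< (r≤n tT) r≢n)

  comp-nonspanning : ∀ {T} → InG λf T → r T ≡ n → r (comp T) ≤ suc k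
  comp-nonspanning {T} vT rT≡n = ≤-reflexive (+-cancelˡ-≡ n _ _
    (trans (cong (_+ r (comp T)) (sym rT≡n)) (trans (vertex-sum vT) (+-comm (suc k) n))))

  tooSmall : ∀ {a b} → a ≤ suc k → b ≤ suc k → ¬ (n + suc k ≤ a + b)
  tooSmall a≤ b≤ big = <-irrefl refl (≤-trans (+-monoˡ-≤ (suc k) (n<1+n (suc k))) (≤-trans big (+-mono-≤ a≤ b≤)))

  spanning : ∀ {T} → r T ≡ n → spans T ≡ true
  spanning {T} = dec-true (r T ≟ n)

  notSpanning : ∀ {T} → r T ≢ n → spans T ≡ false
  notSpanning {T} = dec-false (r T ≟ n)

  opposite : ∀ {T T′ b} → spans T ≡ b → spans T′ ≡ not b → spans T′ ≡ not (spans T)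
  opposite sT sT′ = trans sT′ (cong not (sym sT))

  spans-comp : ∀ {T} → InG λf T → spans (comp T) ≡ not (spans T)
  spans-comp {T} vT with r T ≟ n
  ... | yes rT≡n = opposite (spanning rT≡n) (notSpanning λ rcT≡n →
    <-irrefl (+-cancelʳ-≡ n (suc k) n (trans (sym (vertex-sum vT)) (cong₂ _+_ rT≡n rcT≡n))) (n<1+n (suc k)))
  ... | no rT≢n  = opposite (notSpanning rT≢n) (spanning (≤-antisym (r≤n (Tr-comp (vertex-Tr vT)))
    (+-cancelˡ-≤ (suc k) n (r (comp T))
      (subst (_≤ suc k + r (comp T)) (vertex-sum vT) (+-monoˡ-≤ (r (comp T)) (nonspanning (vertex-Tr vT) rT≢n))))))

  -- Adjacent vertices of G_λ: exactly one of them spans.  Two nonspanning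
  -- ones violate 'adj-sum'; two spanning ones make their complements violate it.
  spans-adj : ∀ {T T′} → InG λf T → InG λf T′ → Adj T T′ → spans T′ ≡ not (spans T)
  spans-adj {T} {T′} vT vT′ adj with r T ≟ n | r T′ ≟ n
  ... | yes rT≡n | no rT′≢n  = opposite (spanning rT≡n) (notSpanning rT′≢n)
  ... | no rT≢n  | yes rT′≡n = opposite (notSpanning rT≢n) (spanning rT′≡n)
  ... | no rT≢n  | no rT′≢n  =
    ⊥-elim (tooSmall (nonspanning (vertex-Tr vT) rT≢n) (nonspanning (vertex-Tr vT′) rT′≢n) (adj-sum adj))
  ... | yes rT≡n | yes rT′≡n =
    ⊥-elim (tooSmall (comp-nonspanning vT rT≡n) (comp-nonspanning vT′ rT′≡n)
                     (adj-sum {comp T} {comp T′} (adj-comp {X = T} {T′} adj)))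

  invariant : Sub n → Bool
  invariant T = spans T xor parity T

  invariant-reach : ∀ {X Y} → Reach λf X Y → invariant Y ≡ invariant X
  invariant-reach (here _)                = refl
  invariant-reach (step {X} {Y} vX adj w) = trans (invariant-reach w) (begin
    spans Y xor parity Y               ≡⟨ cong₂ _xor_ (spans-adj vX (reach-start w) adj) (parity-adj {X = X} {Y} adj) ⟩
    not (spans X) xor not (parity X)   ≡⟨ not-xor-not (spans X) (parity X) ⟩
    spans X xor parity X               ∎)
    where open ≡-Reasoning

  invariant-comp : ∀ {X} → InG λf X → invariant (comp X) ≡ not (invariant X)
  invariant-comp {X} vX = begin
    spans (comp X) xor parity (comp X)   ≡⟨ cong₂ _xor_ (spans-comp vX) (parity-comp X) ⟩
    not (spans X) xor (parity X xor odd n) ≡⟨ cong (λ b → not (spans X) xor (parity X xor b)) n-even ⟩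
    not (spans X) xor (parity X xor false) ≡⟨ cong (not (spans X) xor_) (xor-identityʳ (parity X)) ⟩
    not (spans X) xor parity X           ≡⟨ not-distribˡ-xor (spans X) (parity X) ⟨
    not (spans X xor parity X)           ∎
    where open ≡-Reasoning

  noReach : ¬ ∃ (λ X → Transversal X × Reach λf X (comp X))
  noReach (X , _ , w) = not-¬ refl (trans (sym (invariant-reach w)) (invariant-comp (reach-start w)))

odd-from-% : ∀ n {b} → n % 2 ≡ b2n b → odd n ≡ b
odd-from-% n n%2 = b2n-injective (trans (sym (%2≡odd n)) n%2)

-- The theorem.  Odd n: the parity colouring.  Even n: the component
-- colouring gives sufficiency, the spanning invariant necessity.
-- (Everything holds already for n ≥ 2.)
lemma6 : (n : ℕ) → 3 ≤ n →
    ((n % 2 ≡ 1) → (λf : Sub n → ℕ) → Spiky n λf → IsConnFn λf)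
    × ((n % 2 ≡ 0) → (λf : Sub n → ℕ) → Spiky n λf →
    (IsConnFn λf ⇔ (¬ ∃ (λ X → Transversal X × Reach λf X (comp X)))))
lemma6 zero          ()
lemma6 (suc zero)    (s≤s ())
lemma6 (suc (suc k)) _ = oddCase , evenCase
  where
  n : ℕ
  n = suc (suc k)

  oddCase : n % 2 ≡ 1 → (λf : Sub n → ℕ) → Spiky n λf → IsConnFn λf
  oddCase n%2≡1 λf spiky =
    FromColouring.isConnFn λf spiky (parityColouring λf (odd-from-% n n%2≡1))

  evenCase : n % 2 ≡ 0 → (λf : Sub n → ℕ) → Spiky n λf →
             IsConnFn λf ⇔ (¬ ∃ (λ X → Transversal X × Reach λf X (comp X)))
  evenCase n%2≡0 λf spiky = mk⇔
    (λ (M , λ≡μ) → Necessity.noReach λf spiky n-even M λ≡μ)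
    (λ noReach → FromColouring.isConnFn λf spiky
                   (ComponentColouring.colouring λf (Spiky.symmetric spiky) n-even noReach))
    where
    n-even : odd n ≡ false
    n-even = odd-from-% n n%2≡0
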